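{- Let $p$ be a prime, $k$ an integer with $1<k<p$, $A\subset\mathbb{F}_p$, and $\mathbb{F}$ a field. Identifying $H_{k-1}(X_{A,k};\mathbb{F})$ with a space of skew-symmetric functions on $\mathbb{F}_p^k$ as described in the context, one has $$q\bigl(H_{k-1}(X_{A,k};\mathbb{F})\bigr)=\mathcal{H}(A).$$
   Context: $\mathbb{F}_p=\{0,\ldots,p-1\}$. The sum complex $X_{A,k}$ is the simplicial complex on vertex set $\mathbb{F}_p$ consisting of all subsets of cardinality at most $k-1$ together with all $k$-element subsets $\sigma$ with $\sum_{x\in\sigma}x\in A$. Let $\mathcal{F}(\mathbb{F}_p^k,\mathbb{F})$ be the space of functions $\mathbb{F}_p^k\to\mathbb{F}$. A function $\phi$ is skew-symmetric if $\phi(\gamma_{\sigma^{ -1}(1)},\ldots,\gamma_{\sigma^{ -1}(k)})=\operatorname{sgn}(\sigma)\phi(\gamma_1,\ldots,\gamma_k)$ for all $\gamma\in\mathbb{F}_p^k$ and $\sigma\in S_k$, and, if $\operatorname{char}\mathbb{F}=2$, additionally $\phi(\gamma)=0$ whenever $\gamma_i=\gamma_j$ for some $i\ne j$. For $d\in\mathbb{F}_p$ let $W_d=\{\alpha\in\mathbb{F}_p^k:\sum_i\alpha_i=d\}$. The chain space $C_{k-1}(X_{A,k};\mathbb{F})$ is identified with the space of skew-symmetric $\phi$ with $\operatorname{supp}\phi\subset\bigcup_{a\in A}W_a$ (the coefficient of the oriented face $[\gamma_1,\ldots,\gamma_k]$ being $\phi(\gamma_1,\ldots,\gamma_k)$);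 since $X_{A,k}$ has no $k$-faces, $H_{k-1}(X_{A,k};\mathbb{F})$ is the space of $(k-1)$-cycles, viewed as a subspace of these functions. Let $C_p$ be the multiplicative cyclic group of order $p$, $G=C_p^k$, with a fixed generating set $\{x_1,\ldots,x_k\}$ (so $G$ is the direct product of the cyclic groups $\langle x_j\rangle$); for $\gamma\in\mathbb{F}_p^k$ write $x^\gamma=\prod_j x_j^{\gamma_j}$. Let $q:\mathcal{F}(\mathbb{F}_p^k,\mathbb{F})\to\mathbb{F}[G]$ be the linear isomorphism $q(\phi)=\sum_\gamma\phi(\gamma)x^\gamma$. Let $\mathbb{F}[G]_d=q(\{\phi:\operatorname{supp}\phi\subset W_d\})$, so $\mathbb{F}[G]=\bigoplus_{d\in\mathbb{F}_p}\mathbb{F}[G]_d$, and let $\rho_d$ be the projection onto $\mathbb{F}[G]_d$ along this decomposition. Let $\mathcal{S}=q(\{\text{skew-symmetric }\phi\})$ and $\mathcal{S}_d=\mathcal{S}\cap\mathbb{F}[G]_d$. Define $\mathcal{H}(A)=\{s\in\bigoplus_{a\in A}\mathcal{S}_a:\ \sum_{a\in A}x_i^{ -a}\rho_a(s)=0\text{ for all }1\le i\le k\}$. -}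

module Defs where

open import Level using (Level; _⊔_) renaming (suc to lsuc)
open import Data.Nat as ℕ using (ℕ; zero; suc; _∸_; NonZero)
open import Data.Nat.DivMod using (_mod_)
open import Data.Fin as Fin using (Fin; toℕ)
open import Data.Fin.Subset using (Subset; _∈_; _∉_)
open import Data.Fin.Subset.Properties using (_∈?_)
open import Data.Fin.Permutation using (Permutation′; _⟨$⟩ʳ_; _⟨$⟩ˡ_)
open import Data.Vec using (Vec; []; _∷_; lookup; tabulate; zipWith)
open import Data.Vec.Properties using (≡-dec)
open import Data.Bool using (if_then_else_)
open import Data.Product using (Σ; _×_)
open import Data.Unit.Polymorphic using (⊤)
open import Relation.Nullary using (¬_; Dec; yes; no)
open import Relation.Nullary.Decidable using (⌊_⌋; _×-dec_)
open import Relation.Binary.PropositionalEquality using (_≡_; _≢_)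
open import Algebra.Bundles using (CommutativeRing)

record Field (c ℓ : Level) : Set (lsuc (c ⊔ ℓ)) where
  field
    commutativeRing : CommutativeRing c ℓ
  open CommutativeRing commutativeRing public
  field
    0≉1     : ¬ (0# ≈ 1#)
    inverse : ∀ x → ¬ (x ≈ 0#) → Σ Carrier (λ y → (x * y) ≈ 1#)

module _ {p : ℕ} .{{_ : NonZero p}} where

  0ₚ : Fin p
  0ₚ = 0 mod p

  _+ₚ_ : Fin p → Fin p → Fin p
  a +ₚ b = (toℕ a ℕ.+ toℕ b) mod p

  -ₚ_ : Fin p → Fin p
  -ₚ a = (p ∸ toℕ a) mod p

  Σₚ : {k : ℕ} → Vec (Fin p) k → Fin p
  Σₚ []      = 0ₚ
  Σₚ (a ∷ v) = a +ₚ Σₚ v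

  W : {k : ℕ} → Fin p → Vec (Fin p) k → Set
  W d α = Σₚ α ≡ d

  -- the group C_p^k, written via exponent vectors: x^α · x^β = x^(α+β)
  _·G_ : {k : ℕ} → Vec (Fin p) k → Vec (Fin p) k → Vec (Fin p) k
  _·G_ = zipWith _+ₚ_

  e[_]^-_ : {k : ℕ} → Fin k → Fin p → Vec (Fin p) k
  e[ i ]^- a = tabulate (λ j → if ⌊ i Fin.≟ j ⌋ then -ₚ a else 0ₚ)

Σℕ : (n : ℕ) → (Fin n → ℕ) → ℕ
Σℕ zero    f = 0
Σℕ (suc n) f = f Fin.zero ℕ.+ Σℕ n (λ i → f (Fin.suc i))

inversions : {k : ℕ} → Permutation′ k → ℕ
inversions {k} σ =
  Σℕ k (λ i → Σℕ k (λ j →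
    if ⌊ (i Fin.<? j) ×-dec ((σ ⟨$⟩ʳ j) Fin.<? (σ ⟨$⟩ʳ i)) ⌋ then 1 else 0))

module _ {c ℓ : Level} (𝔽 : Field c ℓ) where
  open Field 𝔽

  signPow : ℕ → Carrier
  signPow zero    = 1#
  signPow (suc n) = - signPow n

  sgn : {k : ℕ} → Permutation′ k → Carrier
  sgn σ = signPow (inversions σ)

  ΣF : (n : ℕ) → (Fin n → Carrier) → Carrier
  ΣF zero    f = 0#
  ΣF (suc n) f = f Fin.zero + ΣF n (λ i → f (Fin.suc i))

  ΣV : (p k : ℕ) → (Vec (Fin p) k → Carrier) → Carrier
  ΣV p zero    f = f []
  ΣV p (suc k) f = ΣF p (λ a → ΣV p k (λ v → f (a ∷ v)))

  -- 𝓕(𝔽_p^k, 𝔽), and 𝔽[G] represented by coefficient functions G → 𝔽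
  Fun : ℕ → ℕ → Set c
  Fun p k = Vec (Fin p) k → Carrier

  GA : ℕ → ℕ → Set c
  GA p k = Vec (Fin p) k → Carrier

  _≈GA_ : {p k : ℕ} → GA p k → GA p k → Set ℓ
  s ≈GA t = ∀ h → s h ≈ t h

  0GA : {p k : ℕ} → GA p k
  0GA _ = 0#

  x^ : {p k : ℕ} → Vec (Fin p) k → GA p k
  x^ γ h = if ⌊ ≡-dec Fin._≟_ γ h ⌋ then 1# else 0#

  _*GA_ : {p k : ℕ} .{{_ : NonZero p}} → GA p k → GA p k → GA p k
  _*GA_ {p} {k} s t h =
    ΣV p k (λ g → ΣV p k (λ g′ → (s g * t g′) * x^ (g ·G g′) h))

  q : {p k : ℕ} → Fun p k → GA p k
  q {p} {k} φ h = ΣV p k (λ γ → φ γ * x^ γ h)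

  permute : {p k : ℕ} → Permutation′ k → Vec (Fin p) k → Vec (Fin p) k
  permute σ γ = tabulate (λ i → lookup γ (σ ⟨$⟩ˡ i))

  SkewSymmetric : {p k : ℕ} → Fun p k → Set ℓ
  SkewSymmetric {p} {k} φ =
    (∀ (γ : Vec (Fin p) k) (σ : Permutation′ k) → φ (permute σ γ) ≈ (sgn σ * φ γ))
    × ((1# + 1#) ≈ 0# →
       ∀ (γ : Vec (Fin p) k) (i j : Fin k) → i ≢ j → lookup γ i ≡ lookup γ j → φ γ ≈ 0#)

  module _ {p : ℕ} .{{_ : NonZero p}} where

    ρ : {k : ℕ} → Fin p → GA p k → GA p k
    ρ d s γ = if ⌊ Σₚ γ Fin.≟ d ⌋ then s γ else 0#

    ΣA : {k : ℕ} → Subset p → (Fin p → GA p k) → GA p k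
    ΣA A t h = ΣF p (λ a → if ⌊ a ∈? A ⌋ then t a h else 0#)

    GA[_] : {k : ℕ} → Fin p → GA p k → Set (c ⊔ ℓ)
    GA[_] {k} d s = Σ (Fun p k) (λ φ → (∀ γ → ¬ W d γ → φ γ ≈ 0#) × (q φ ≈GA s))

    𝒮 : {k : ℕ} → GA p k → Set (c ⊔ ℓ)
    𝒮 {k} s = Σ (Fun p k) (λ φ → SkewSymmetric φ × (q φ ≈GA s))

    𝒮[_] : {k : ℕ} → Fin p → GA p k → Set (c ⊔ ℓ)
    𝒮[ d ] s = 𝒮 s × GA[ d ] s

    ⊕𝒮 : {k : ℕ} → Subset p → GA p k → Set (c ⊔ ℓ)
    ⊕𝒮 {k} A s = Σ (Fin p → GA p k) (λ t → (∀ a → a ∈ A → 𝒮[ a ] (t a)) × (s ≈GA ΣA A t))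

    ℋ : {k : ℕ} → Subset p → GA p k → Set (c ⊔ ℓ)
    ℋ {k} A s = ⊕𝒮 A s × (∀ (i : Fin k) → ΣA A (λ a → x^ (e[ i ]^- a) *GA ρ a s) ≈GA 0GA)

    -- (k-1)-chains of X_{A,k}: skew-symmetric φ supported on ⋃_{a∈A} W_a
    Chain : {k : ℕ} → Subset p → Fun p k → Set ℓ
    Chain {k} A φ = SkewSymmetric φ × (∀ (γ : Vec (Fin p) k) → Σₚ γ ∉ A → φ γ ≈ 0#)

    -- ∂φ = 0, where (∂φ)(β) = Σ_{v ∈ 𝔽_p} φ(v, β_1, …, β_{k-1}),
    -- the coefficient of [β] in ∂(Σ φ(σ)[σ]) with ∂[v,β] = [β] - …
    Cycle : {k : ℕ} → Fun p k → Set ℓ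
    Cycle {zero}  φ = ⊤
    Cycle {suc k} φ = ∀ (β : Vec (Fin p) k) → ΣF p (λ v → φ (v ∷ β)) ≈ 0#

    -- H_{k-1}(X_{A,k}; 𝔽) = (k-1)-cycles (there are no k-faces)
    H : {k : ℕ} → Subset p → Fun p k → Set ℓ
    H A φ = Chain A φ × Cycle φ

    q[H]≡ℋ : (k : ℕ) → Subset p → Set (c ⊔ ℓ)
    q[H]≡ℋ k A =
      (∀ (φ : Fun p k) → H A φ → ℋ A (q φ))
      × (∀ (s : GA p k) → ℋ A s → Σ (Fun p k) (λ φ → H A φ × (q φ ≈GA s)))

-- The map q is the identity on coefficient functions, and an element of ⊕_{a∈A} 𝒮_a is just a
-- skew-symmetric s supported on ⋃_{a∈A} W_a. So it remains to see that for such s, ∂s = 0 iff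
-- Σ_{a∈A} x_i^{-a} ρ_a(s) = 0 for every i.
-- The coefficient of x^h in Σ_{a∈A} x_i^{-a} ρ_a(s) is Σ_{a∈A} ρ_a(s)(h + a e_i). It vanishes
-- unless h ∈ W_0, and for h ∈ W_0 the point h + a e_i lies in W_a, so by the support condition it
-- equals the sum of s over the whole line {h + v e_i : v ∈ 𝔽_p}. Skew-symmetry (the transposition
-- of coordinates 0 and i) turns these line sums in direction i into line sums in direction 0,
-- which are exactly the coefficients of ∂s.

module Submission where

open import Defs
open import Level using (Level; 0ℓ)
open import Function using (_∘_)
open import Data.Nat as ℕ using (ℕ; zero; suc; NonZero; _<_; _%_; _∸_)
open import Data.Nat.DivMod using (%-distribˡ-+; m%n%n≡m%n; m<n⇒m%n≡m; n%n≡0)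
open import Data.Nat.Properties using (+-comm; +-assoc; m∸n+n≡m; <⇒≤)
open import Data.Nat.Primality using (Prime; prime⇒nonZero)
open import Data.Fin as Fin using (Fin; toℕ)
open import Data.Fin.Properties using (suc-injective; toℕ-fromℕ<; toℕ-injective; toℕ<n)
open import Data.Fin.Subset using (Subset; _∈_; _∉_)
open import Data.Fin.Subset.Properties using (_∈?_)
open import Data.Fin.Permutation
  using (Permutation′; permutation; flip; transpose; _⟨$⟩ʳ_; _⟨$⟩ˡ_; inverseˡ; inverseʳ)
open import Data.Vec using (Vec; []; _∷_; head; tail; lookup; tabulate; _[_]≔_)
open import Data.Vec.Properties
  using (≡-dec; lookup∘tabulate; tabulate∘lookup; tabulate-cong; lookup-zipWith; lookup∘update; lookup∘update′)
open import Data.Bool using (if_then_else_)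
open import Data.Product using (_,_; proj₁; proj₂)
open import Relation.Nullary using (¬_; Dec; yes; no; contradiction)
open import Relation.Nullary.Decidable using (⌊_⌋)
open import Relation.Binary.PropositionalEquality as ≡
  using (_≡_; _≢_; cong; cong₂; module ≡-Reasoning)
open import Algebra.Bundles using (AbelianGroup)
import Algebra.Structures as Structures
import Algebra.Properties.AbelianGroup as AbelianGroupProperties
import Algebra.Properties.CommutativeSemigroup as CommutativeSemigroupProperties
import Algebra.Properties.CommutativeMonoid.Sum as CommutativeMonoidSum

lookup-≗⇒≡ : {A : Set} {n : ℕ} {u v : Vec A n} → (∀ j → lookup u j ≡ lookup v j) → u ≡ v
lookup-≗⇒≡ {u = u} {v} eq =
  ≡.trans (≡.sym (tabulate∘lookup u)) (≡.trans (tabulate-cong eq) (tabulate∘lookup v))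

module _ {p : ℕ} .{{_ : NonZero p}} where

  private
    %-absorbˡ : ∀ m n → (m % p ℕ.+ n) % p ≡ (m ℕ.+ n) % p
    %-absorbˡ m n = begin
      (m % p ℕ.+ n) % p           ≡⟨ %-distribˡ-+ (m % p) n p ⟩
      (m % p % p ℕ.+ n % p) % p   ≡⟨ cong (λ x → (x ℕ.+ n % p) % p) (m%n%n≡m%n m p) ⟩
      (m % p ℕ.+ n % p) % p       ≡⟨ %-distribˡ-+ m n p ⟨
      (m ℕ.+ n) % p               ∎
      where open ≡-Reasoning

  toℕ-+ₚ : ∀ a b → toℕ (a +ₚ b) ≡ (toℕ a ℕ.+ toℕ b) % p
  toℕ-+ₚ a b = toℕ-fromℕ< _

  toℕ-0ₚ : toℕ (0ₚ {p}) ≡ 0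
  toℕ-0ₚ = ≡.trans (toℕ-fromℕ< _) (m<n⇒m%n≡m (ℕ.>-nonZero⁻¹ p))

  +ₚ-comm : ∀ a b → a +ₚ b ≡ b +ₚ a
  +ₚ-comm a b = toℕ-injective (begin
    toℕ (a +ₚ b)             ≡⟨ toℕ-+ₚ a b ⟩
    (toℕ a ℕ.+ toℕ b) % p    ≡⟨ cong (_% p) (+-comm (toℕ a) (toℕ b)) ⟩
    (toℕ b ℕ.+ toℕ a) % p    ≡⟨ toℕ-+ₚ b a ⟨
    toℕ (b +ₚ a)             ∎)
    where open ≡-Reasoning

  +ₚ-assoc : ∀ a b c → (a +ₚ b) +ₚ c ≡ a +ₚ (b +ₚ c)
  +ₚ-assoc a b c = toℕ-injective (begin
    toℕ ((a +ₚ b) +ₚ c)                     ≡⟨ toℕ-+ₚ (a +ₚ b) c ⟩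
    (toℕ (a +ₚ b) ℕ.+ toℕ c) % p            ≡⟨ cong (λ x → (x ℕ.+ toℕ c) % p) (toℕ-+ₚ a b) ⟩
    ((toℕ a ℕ.+ toℕ b) % p ℕ.+ toℕ c) % p   ≡⟨ %-absorbˡ (toℕ a ℕ.+ toℕ b) (toℕ c) ⟩
    (toℕ a ℕ.+ toℕ b ℕ.+ toℕ c) % p         ≡⟨ cong (_% p) (+-assoc (toℕ a) (toℕ b) (toℕ c)) ⟩
    (toℕ a ℕ.+ (toℕ b ℕ.+ toℕ c)) % p       ≡⟨ cong (_% p) (+-comm (toℕ a) _) ⟩
    ((toℕ b ℕ.+ toℕ c) ℕ.+ toℕ a) % p       ≡⟨ %-absorbˡ (toℕ b ℕ.+ toℕ c) (toℕ a) ⟨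
    ((toℕ b ℕ.+ toℕ c) % p ℕ.+ toℕ a) % p   ≡⟨ cong (λ x → (x ℕ.+ toℕ a) % p) (toℕ-+ₚ b c) ⟨
    (toℕ (b +ₚ c) ℕ.+ toℕ a) % p            ≡⟨ toℕ-+ₚ (b +ₚ c) a ⟨
    toℕ ((b +ₚ c) +ₚ a)                     ≡⟨ cong toℕ (+ₚ-comm (b +ₚ c) a) ⟩
    toℕ (a +ₚ (b +ₚ c))                     ∎)
    where open ≡-Reasoning

  +ₚ-identityˡ : ∀ a → 0ₚ +ₚ a ≡ a
  +ₚ-identityˡ a = toℕ-injective (begin
    toℕ (0ₚ +ₚ a)                  ≡⟨ toℕ-+ₚ 0ₚ a ⟩
    (toℕ (0ₚ {p}) ℕ.+ toℕ a) % p   ≡⟨ cong (λ x → (x ℕ.+ toℕ a) % p) toℕ-0ₚ ⟩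
    toℕ a % p                      ≡⟨ m<n⇒m%n≡m (toℕ<n a) ⟩
    toℕ a                          ∎)
    where open ≡-Reasoning

  -ₚ-inverseˡ : ∀ a → (-ₚ a) +ₚ a ≡ 0ₚ
  -ₚ-inverseˡ a = toℕ-injective (begin
    toℕ ((-ₚ a) +ₚ a)                  ≡⟨ toℕ-+ₚ (-ₚ a) a ⟩
    (toℕ (-ₚ a) ℕ.+ toℕ a) % p         ≡⟨ cong (λ x → (x ℕ.+ toℕ a) % p) (toℕ-fromℕ< _) ⟩
    ((p ∸ toℕ a) % p ℕ.+ toℕ a) % p    ≡⟨ %-absorbˡ (p ∸ toℕ a) (toℕ a) ⟩
    (p ∸ toℕ a ℕ.+ toℕ a) % p          ≡⟨ cong (_% p) (m∸n+n≡m (<⇒≤ (toℕ<n a))) ⟩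
    p % p                              ≡⟨ n%n≡0 p ⟩
    0                                  ≡⟨ toℕ-0ₚ ⟨
    toℕ (0ₚ {p})                       ∎)
    where open ≡-Reasoning

  +ₚ-isAbelianGroup : Structures.IsAbelianGroup (_≡_ {A = Fin p}) _+ₚ_ 0ₚ -ₚ_
  +ₚ-isAbelianGroup = record
    { isGroup = record
      { isMonoid = record
        { isSemigroup = record
          { isMagma = record { isEquivalence = ≡.isEquivalence ; ∙-cong = cong₂ _+ₚ_ }
          ; assoc = +ₚ-assoc
          }
        ; identity = +ₚ-identityˡ , λ a → ≡.trans (+ₚ-comm a 0ₚ) (+ₚ-identityˡ a)
        }
      ; inverse = -ₚ-inverseˡ , λ a → ≡.trans (+ₚ-comm a (-ₚ a)) (-ₚ-inverseˡ a)
      ; ⁻¹-cong = cong -ₚ_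
      }
    ; comm = +ₚ-comm
    }

  +ₚ-abelianGroup : AbelianGroup 0ℓ 0ℓ
  +ₚ-abelianGroup = record { isAbelianGroup = +ₚ-isAbelianGroup }

module _ {p : ℕ} .{{_ : NonZero p}} where

  open AbelianGroup (+ₚ-abelianGroup {p}) using (commutativeSemigroup; commutativeMonoid)
    renaming (identityʳ to +ₚ-identityʳ)
  open AbelianGroupProperties (+ₚ-abelianGroup {p})
    using (∙-cancelˡ; \\-leftDividesʳ; //-rightDividesˡ; //-rightDividesʳ)
  open CommutativeSemigroupProperties commutativeSemigroup using (x∙yz≈y∙xz)
  module ℤₚ = CommutativeMonoidSum commutativeMonoid

  Σₚ≡sum : ∀ {k} (γ : Vec (Fin p) k) → Σₚ γ ≡ ℤₚ.sum (lookup γ)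
  Σₚ≡sum []      = ≡.refl
  Σₚ≡sum (a ∷ γ) = cong (a +ₚ_) (Σₚ≡sum γ)

  Σₚ-permute : ∀ {k} (σ : Permutation′ k) (γ : Vec (Fin p) k) →
               Σₚ (tabulate (lookup γ ∘ (σ ⟨$⟩ˡ_))) ≡ Σₚ γ
  Σₚ-permute σ γ = begin
    Σₚ (tabulate γσ)               ≡⟨ Σₚ≡sum (tabulate γσ) ⟩
    ℤₚ.sum (lookup (tabulate γσ))  ≡⟨ ℤₚ.sum-cong-≗ (lookup∘tabulate γσ) ⟩
    ℤₚ.sum γσ                      ≡⟨ ℤₚ.sum-permute (lookup γ) (flip σ) ⟨
    ℤₚ.sum (lookup γ)              ≡⟨ Σₚ≡sum γ ⟨
    Σₚ γ                           ∎
    where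
    open ≡-Reasoning
    γσ = lookup γ ∘ (σ ⟨$⟩ˡ_)

  Σₚ-update : ∀ {k} (h : Vec (Fin p) k) i a → Σₚ (h [ i ]≔ (a +ₚ lookup h i)) ≡ a +ₚ Σₚ h
  Σₚ-update (x ∷ h) Fin.zero    a = +ₚ-assoc a x (Σₚ h)
  Σₚ-update (x ∷ h) (Fin.suc i) a =
    ≡.trans (cong (x +ₚ_) (Σₚ-update h i a)) (x∙yz≈y∙xz x a (Σₚ h))

  W₀-update : ∀ {k} (h : Vec (Fin p) k) i a → W 0ₚ h → W a (h [ i ]≔ (a +ₚ lookup h i))
  W₀-update h i a h∈W₀ =
    ≡.trans (Σₚ-update h i a) (≡.trans (cong (a +ₚ_) h∈W₀) (+ₚ-identityʳ a))

  W-update⇒W₀ : ∀ {k} (h : Vec (Fin p) k) i a → W a (h [ i ]≔ (a +ₚ lookup h i)) → W 0ₚ h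
  W-update⇒W₀ h i a h′∈Wₐ = ∙-cancelˡ a (Σₚ h) 0ₚ
    (≡.trans (≡.sym (Σₚ-update h i a)) (≡.trans h′∈Wₐ (≡.sym (+ₚ-identityʳ a))))

  ·G-cancelˡ : ∀ {k} (e g g′ : Vec (Fin p) k) → e ·G g ≡ e ·G g′ → g ≡ g′
  ·G-cancelˡ []      []      []        _  = ≡.refl
  ·G-cancelˡ (a ∷ e) (b ∷ g) (b′ ∷ g′) eq =
    cong₂ _∷_ (∙-cancelˡ a b b′ (cong head eq)) (·G-cancelˡ e g g′ (cong tail eq))

  e^-·G-update : ∀ {k} (i : Fin k) a (h : Vec (Fin p) k) →
                 (e[ i ]^- a) ·G (h [ i ]≔ (a +ₚ lookup h i)) ≡ h
  e^-·G-update i a h = lookup-≗⇒≡ λ j → begin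
      lookup ((e[ i ]^- a) ·G h′) j                        ≡⟨ lookup-zipWith _+ₚ_ j (e[ i ]^- a) h′ ⟩
      lookup (e[ i ]^- a) j +ₚ lookup h′ j                ≡⟨ cong (_+ₚ lookup h′ j) (lookup∘tabulate _ j) ⟩
      (if ⌊ i Fin.≟ j ⌋ then -ₚ a else 0ₚ) +ₚ lookup h′ j  ≡⟨ coordinate j (i Fin.≟ j) ⟩
      lookup h j                                          ∎
    where
    open ≡-Reasoning
    h′ = h [ i ]≔ (a +ₚ lookup h i)
    coordinate : ∀ j (i≟j : Dec (i ≡ j)) →
                 (if ⌊ i≟j ⌋ then -ₚ a else 0ₚ) +ₚ lookup h′ j ≡ lookup h j
    coordinate j (yes ≡.refl) =
      ≡.trans (cong ((-ₚ a) +ₚ_) (lookup∘update i h _)) (\\-leftDividesʳ a (lookup h i))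
    coordinate j (no i≢j) =
      ≡.trans (+ₚ-identityˡ (lookup h′ j)) (lookup∘update′ (i≢j ∘ ≡.sym) h _)

  translation : Fin p → Permutation′ p
  translation c = permutation (_+ₚ c) (_+ₚ (-ₚ c)) (//-rightDividesˡ c) (//-rightDividesʳ c)

module _ {c ℓ : Level} (𝔽 : Field c ℓ) where

  permute-update : ∀ {p k} (σ : Permutation′ k) (γ : Vec (Fin p) k) i v →
                   permute 𝔽 σ (γ [ i ]≔ v) ≡ permute 𝔽 σ γ [ σ ⟨$⟩ʳ i ]≔ v
  permute-update σ γ i v = lookup-≗⇒≡ λ m →
      ≡.trans (lookup∘tabulate _ m) (coordinate m (m Fin.≟ σ ⟨$⟩ʳ i))
    where
    open ≡-Reasoning
    coordinate : ∀ m → Dec (m ≡ σ ⟨$⟩ʳ i) →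
                 lookup (γ [ i ]≔ v) (σ ⟨$⟩ˡ m) ≡ lookup (permute 𝔽 σ γ [ σ ⟨$⟩ʳ i ]≔ v) m
    coordinate m (yes ≡.refl) = begin
      lookup (γ [ i ]≔ v) (σ ⟨$⟩ˡ (σ ⟨$⟩ʳ i))            ≡⟨ cong (lookup (γ [ i ]≔ v)) (inverseˡ σ) ⟩
      lookup (γ [ i ]≔ v) i                              ≡⟨ lookup∘update i γ v ⟩
      v                                                  ≡⟨ lookup∘update (σ ⟨$⟩ʳ i) (permute 𝔽 σ γ) v ⟨
      lookup (permute 𝔽 σ γ [ σ ⟨$⟩ʳ i ]≔ v) (σ ⟨$⟩ʳ i)  ∎
    coordinate m (no m≢σi) = begin
      lookup (γ [ i ]≔ v) (σ ⟨$⟩ˡ m)            ≡⟨ lookup∘update′ σm≢i γ v ⟩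
      lookup γ (σ ⟨$⟩ˡ m)                       ≡⟨ lookup∘tabulate _ m ⟨
      lookup (permute 𝔽 σ γ) m                  ≡⟨ lookup∘update′ m≢σi (permute 𝔽 σ γ) v ⟨
      lookup (permute 𝔽 σ γ [ σ ⟨$⟩ʳ i ]≔ v) m  ∎
      where
      σm≢i : σ ⟨$⟩ˡ m ≢ i
      σm≢i σm≡i = m≢σi (≡.trans (≡.sym (inverseʳ σ)) (cong (σ ⟨$⟩ʳ_) σm≡i))

  permute-flip : ∀ {p k} (σ : Permutation′ k) (γ : Vec (Fin p) k) →
                 permute 𝔽 σ (permute 𝔽 (flip σ) γ) ≡ γ
  permute-flip σ γ = lookup-≗⇒≡ λ m →
    ≡.trans (lookup∘tabulate _ m) (≡.trans (lookup∘tabulate _ (σ ⟨$⟩ˡ m)) (cong (lookup γ) (inverseʳ σ)))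

module _ {c ℓ : Level} (𝔽 : Field c ℓ) where

  open Field 𝔽
  open import Relation.Binary.Reasoning.Setoid setoid
  module 𝔽Σ = CommutativeMonoidSum +-commutativeMonoid

  if-holds : ∀ {P : Set} (P? : Dec P) {x y : Carrier} → P → (if ⌊ P? ⌋ then x else y) ≈ x
  if-holds (yes _) _  = refl
  if-holds (no ¬P) P  = contradiction P ¬P

  if-fails : ∀ {P : Set} (P? : Dec P) {x y : Carrier} → ¬ P → (if ⌊ P? ⌋ then x else y) ≈ y
  if-fails (yes P) ¬P = contradiction P ¬P
  if-fails (no _)  _  = refl

  guarded-cong : ∀ {P : Set} (P? : Dec P) {x y : Carrier} → (P → x ≈ y) →
                 (if ⌊ P? ⌋ then x else 0#) ≈ (if ⌊ P? ⌋ then y else 0#)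
  guarded-cong (yes P) x≈y = x≈y P
  guarded-cong (no _)  _   = refl

  guarded-zero : ∀ {P : Set} (P? : Dec P) {x : Carrier} → (P → x ≈ 0#) →
                 (if ⌊ P? ⌋ then x else 0#) ≈ 0#
  guarded-zero (yes P) x≈0 = x≈0 P
  guarded-zero (no _)  _   = refl

  guarded-elim : ∀ {P : Set} (P? : Dec P) {x : Carrier} → (¬ P → x ≈ 0#) →
                 (if ⌊ P? ⌋ then x else 0#) ≈ x
  guarded-elim (yes _) _   = refl
  guarded-elim (no ¬P) x≈0 = sym (x≈0 ¬P)

  guarded-* : ∀ {P : Set} (P? : Dec P) (z x : Carrier) →
              (if ⌊ P? ⌋ then z * x else 0#) ≈ z * (if ⌊ P? ⌋ then x else 0#)
  guarded-* (yes _) z x = refl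
  guarded-* (no _)  z x = sym (zeroʳ z)

  ΣF≡sum : ∀ n (f : Fin n → Carrier) → ΣF 𝔽 n f ≡ 𝔽Σ.sum f
  ΣF≡sum zero    f = ≡.refl
  ΣF≡sum (suc n) f = cong (f Fin.zero +_) (ΣF≡sum n (f ∘ Fin.suc))

  ΣF-cong : ∀ n {f g : Fin n → Carrier} → (∀ i → f i ≈ g i) → ΣF 𝔽 n f ≈ ΣF 𝔽 n g
  ΣF-cong zero    f≈g = refl
  ΣF-cong (suc n) f≈g = +-cong (f≈g Fin.zero) (ΣF-cong n (f≈g ∘ Fin.suc))

  ΣF-zero : ∀ n {f : Fin n → Carrier} → (∀ i → f i ≈ 0#) → ΣF 𝔽 n f ≈ 0#
  ΣF-zero zero    f≈0 = refl
  ΣF-zero (suc n) f≈0 = trans (+-cong (f≈0 Fin.zero) (ΣF-zero n (f≈0 ∘ Fin.suc))) (+-identityˡ 0#)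

  ΣF-single : ∀ n {f : Fin n → Carrier} (j : Fin n) → (∀ i → i ≢ j → f i ≈ 0#) → ΣF 𝔽 n f ≈ f j
  ΣF-single (suc n) Fin.zero    f≈0 =
    trans (+-congˡ (ΣF-zero n (λ i → f≈0 (Fin.suc i) λ ()))) (+-identityʳ _)
  ΣF-single (suc n) (Fin.suc j) f≈0 =
    trans (+-cong (f≈0 Fin.zero λ ()) (ΣF-single n j (λ i i≢j → f≈0 (Fin.suc i) (i≢j ∘ suc-injective))))
          (+-identityˡ _)

  *-distribˡ-ΣF : ∀ n x (f : Fin n → Carrier) → x * ΣF 𝔽 n f ≈ ΣF 𝔽 n (λ i → x * f i)
  *-distribˡ-ΣF zero    x f = zeroʳ x
  *-distribˡ-ΣF (suc n) x f = trans (distribˡ x _ _) (+-congˡ (*-distribˡ-ΣF n x (f ∘ Fin.suc)))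

  ΣF-permute : ∀ n (f : Fin n → Carrier) (π : Permutation′ n) →
               ΣF 𝔽 n (f ∘ (π ⟨$⟩ʳ_)) ≈ ΣF 𝔽 n f
  ΣF-permute n f π = begin
    ΣF 𝔽 n (f ∘ (π ⟨$⟩ʳ_))   ≡⟨ ΣF≡sum n _ ⟩
    𝔽Σ.sum (f ∘ (π ⟨$⟩ʳ_))   ≈⟨ 𝔽Σ.sum-permute f π ⟨
    𝔽Σ.sum f                 ≡⟨ ΣF≡sum n f ⟨
    ΣF 𝔽 n f                 ∎

  ΣV-zero : ∀ p k {f : Vec (Fin p) k → Carrier} → (∀ v → f v ≈ 0#) → ΣV 𝔽 p k f ≈ 0#
  ΣV-zero p zero    f≈0 = f≈0 []
  ΣV-zero p (suc k) f≈0 = ΣF-zero p (λ a → ΣV-zero p k (f≈0 ∘ (a ∷_)))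

  ΣV-single : ∀ p k {f : Vec (Fin p) k → Carrier} (w : Vec (Fin p) k) →
              (∀ v → v ≢ w → f v ≈ 0#) → ΣV 𝔽 p k f ≈ f w
  ΣV-single p zero    []      f≈0 = refl
  ΣV-single p (suc k) (a ∷ w) f≈0 =
    trans (ΣF-single p a (λ b b≢a → ΣV-zero p k (λ v → f≈0 (b ∷ v) (b≢a ∘ cong head))))
          (ΣV-single p k w (λ v v≢w → f≈0 (a ∷ v) (v≢w ∘ cong tail)))

  x^-≡ : ∀ {p k} {γ h : Vec (Fin p) k} → γ ≡ h → x^ 𝔽 γ h ≈ 1#
  x^-≡ {γ = γ} {h} = if-holds (≡-dec Fin._≟_ γ h)

  x^-≢ : ∀ {p k} {γ h : Vec (Fin p) k} → γ ≢ h → x^ 𝔽 γ h ≈ 0#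
  x^-≢ {γ = γ} {h} = if-fails (≡-dec Fin._≟_ γ h)

  q-identity : ∀ {p k} (φ : Fun 𝔽 p k) → _≈GA_ 𝔽 (q 𝔽 φ) φ
  q-identity {p} {k} φ h = begin
    ΣV 𝔽 p k (λ γ → φ γ * x^ 𝔽 γ h)
      ≈⟨ ΣV-single p k h (λ γ γ≢h → trans (*-congˡ (x^-≢ γ≢h)) (zeroʳ _)) ⟩
    φ h * x^ 𝔽 h h   ≈⟨ *-congˡ (x^-≡ ≡.refl) ⟩
    φ h * 1#         ≈⟨ *-identityʳ _ ⟩
    φ h              ∎

  SkewSymmetric-resp : ∀ {p k} {φ ψ : Fun 𝔽 p k} →
                       _≈GA_ 𝔽 φ ψ → SkewSymmetric 𝔽 φ → SkewSymmetric 𝔽 ψ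
  SkewSymmetric-resp φ≈ψ (antisym , alternating) =
    (λ γ σ → trans (sym (φ≈ψ _)) (trans (antisym γ σ) (*-congˡ (φ≈ψ γ)))) ,
    (λ char2 γ i j i≢j γi≡γj → trans (sym (φ≈ψ γ)) (alternating char2 γ i j i≢j γi≡γj))

  𝒮-skew : ∀ {p k} .{{_ : NonZero p}} {s : GA 𝔽 p k} → 𝒮 𝔽 s → SkewSymmetric 𝔽 s
  𝒮-skew (φ , skew , qφ≈s) = SkewSymmetric-resp (λ h → trans (sym (q-identity φ h)) (qφ≈s h)) skew

  Cycle-resp : ∀ {p k} .{{_ : NonZero p}} {φ ψ : Fun 𝔽 p k} →
               _≈GA_ 𝔽 φ ψ → Cycle 𝔽 φ → Cycle 𝔽 ψ
  Cycle-resp {k = zero}      _   _     = _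
  Cycle-resp {p} {k = suc k} φ≈ψ cycle β = trans (ΣF-cong p (λ v → sym (φ≈ψ (v ∷ β)))) (cycle β)

  module _ {p : ℕ} .{{_ : NonZero p}} where

    SupportedOver : ∀ {k} → Subset p → GA 𝔽 p k → Set ℓ
    SupportedOver A s = ∀ γ → Σₚ γ ∉ A → s γ ≈ 0#

    lineSum : ∀ {k} → Fin k → GA 𝔽 p k → GA 𝔽 p k
    lineSum i s h = ΣF 𝔽 p (λ v → s (h [ i ]≔ v))

    shiftSum : ∀ {k} → Fin k → Subset p → GA 𝔽 p k → GA 𝔽 p k
    shiftSum i A s = ΣA 𝔽 A (λ a → _*GA_ 𝔽 (x^ 𝔽 (e[ i ]^- a)) (ρ 𝔽 a s))

    H-resp : ∀ {k} {A : Subset p} {φ ψ : Fun 𝔽 p k} → _≈GA_ 𝔽 φ ψ → H 𝔽 A φ → H 𝔽 A ψ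
    H-resp φ≈ψ ((skew , supp) , cycle) =
      (SkewSymmetric-resp φ≈ψ skew , (λ γ Σγ∉A → trans (sym (φ≈ψ γ)) (supp γ Σγ∉A))) ,
      Cycle-resp φ≈ψ cycle

    GA[]-support : ∀ {k} {d} {s : GA 𝔽 p k} → GA[_] 𝔽 d s → ∀ γ → ¬ W d γ → s γ ≈ 0#
    GA[]-support (φ , supp , qφ≈s) γ γ∉W =
      trans (sym (qφ≈s γ)) (trans (q-identity φ γ) (supp γ γ∉W))

    ρ-on : ∀ {k} {d} (s : GA 𝔽 p k) γ → W d γ → ρ 𝔽 d s γ ≈ s γ
    ρ-on {d = d} s γ = if-holds (Σₚ γ Fin.≟ d)

    ρ-off : ∀ {k} {d} (s : GA 𝔽 p k) γ → ¬ W d γ → ρ 𝔽 d s γ ≈ 0#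
    ρ-off {d = d} s γ = if-fails (Σₚ γ Fin.≟ d)

    ρ-skew : ∀ {k} d {φ : Fun 𝔽 p k} → SkewSymmetric 𝔽 φ → SkewSymmetric 𝔽 (ρ 𝔽 d φ)
    ρ-skew d {φ} (antisym , alternating) = antisym′ , alternating′
      where
      antisym′ : ∀ γ σ → ρ 𝔽 d φ (permute 𝔽 σ γ) ≈ sgn 𝔽 σ * ρ 𝔽 d φ γ
      antisym′ γ σ = by-cases (Σₚ γ Fin.≟ d)
        where
        by-cases : Dec (W d γ) → ρ 𝔽 d φ (permute 𝔽 σ γ) ≈ sgn 𝔽 σ * ρ 𝔽 d φ γ
        by-cases (yes γ∈W) = begin
          ρ 𝔽 d φ (permute 𝔽 σ γ)  ≈⟨ ρ-on φ _ (≡.trans (Σₚ-permute σ γ) γ∈W) ⟩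
          φ (permute 𝔽 σ γ)        ≈⟨ antisym γ σ ⟩
          sgn 𝔽 σ * φ γ            ≈⟨ *-congˡ (ρ-on φ γ γ∈W) ⟨
          sgn 𝔽 σ * ρ 𝔽 d φ γ      ∎
        by-cases (no γ∉W) = begin
          ρ 𝔽 d φ (permute 𝔽 σ γ)  ≈⟨ ρ-off φ _ (γ∉W ∘ ≡.trans (≡.sym (Σₚ-permute σ γ))) ⟩
          0#                       ≈⟨ zeroʳ _ ⟨
          sgn 𝔽 σ * 0#             ≈⟨ *-congˡ (ρ-off φ γ γ∉W) ⟨
          sgn 𝔽 σ * ρ 𝔽 d φ γ      ∎
      alternating′ : (1# + 1#) ≈ 0# → ∀ γ i j → i ≢ j → lookup γ i ≡ lookup γ j → ρ 𝔽 d φ γ ≈ 0#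
      alternating′ char2 γ i j i≢j γi≡γj =
        guarded-zero (Σₚ γ Fin.≟ d) (λ _ → alternating char2 γ i j i≢j γi≡γj)

    ΣA-skew : ∀ {k} (A : Subset p) {t : Fin p → GA 𝔽 p k} →
              (∀ a → a ∈ A → SkewSymmetric 𝔽 (t a)) → SkewSymmetric 𝔽 (ΣA 𝔽 A t)
    ΣA-skew A {t} skew = antisym′ , alternating′
      where
      antisym′ : ∀ γ σ → ΣA 𝔽 A t (permute 𝔽 σ γ) ≈ sgn 𝔽 σ * ΣA 𝔽 A t γ
      antisym′ γ σ = begin
        ΣF 𝔽 p (λ a → if ⌊ a ∈? A ⌋ then t a (permute 𝔽 σ γ) else 0#)
          ≈⟨ ΣF-cong p (λ a → guarded-cong (a ∈? A) (λ a∈A → proj₁ (skew a a∈A) γ σ)) ⟩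
        ΣF 𝔽 p (λ a → if ⌊ a ∈? A ⌋ then sgn 𝔽 σ * t a γ else 0#)
          ≈⟨ ΣF-cong p (λ a → guarded-* (a ∈? A) (sgn 𝔽 σ) (t a γ)) ⟩
        ΣF 𝔽 p (λ a → sgn 𝔽 σ * (if ⌊ a ∈? A ⌋ then t a γ else 0#))
          ≈⟨ *-distribˡ-ΣF p (sgn 𝔽 σ) _ ⟨
        sgn 𝔽 σ * ΣA 𝔽 A t γ
          ∎
      alternating′ : (1# + 1#) ≈ 0# → ∀ γ i j → i ≢ j → lookup γ i ≡ lookup γ j → ΣA 𝔽 A t γ ≈ 0#
      alternating′ char2 γ i j i≢j γi≡γj =
        ΣF-zero p (λ a → guarded-zero (a ∈? A) (λ a∈A → proj₂ (skew a a∈A) char2 γ i j i≢j γi≡γj))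

    ΣA-ρ : ∀ {k} (A : Subset p) (s : GA 𝔽 p k) → SupportedOver A s →
           _≈GA_ 𝔽 s (ΣA 𝔽 A (λ a → ρ 𝔽 a s))
    ΣA-ρ A s supp h = sym (begin
      ΣF 𝔽 p (λ a → if ⌊ a ∈? A ⌋ then ρ 𝔽 a s h else 0#)
        ≈⟨ ΣF-single p (Σₚ h) (λ a a≢Σh → guarded-zero (a ∈? A) (λ _ → ρ-off s h (a≢Σh ∘ ≡.sym))) ⟩
      (if ⌊ Σₚ h ∈? A ⌋ then ρ 𝔽 (Σₚ h) s h else 0#)
        ≈⟨ guarded-cong (Σₚ h ∈? A) (λ _ → ρ-on s h ≡.refl) ⟩
      (if ⌊ Σₚ h ∈? A ⌋ then s h else 0#)
        ≈⟨ guarded-elim (Σₚ h ∈? A) (supp h) ⟩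
      s h
        ∎)

    x^-*GA : ∀ {k} (e : Vec (Fin p) k) (r : GA 𝔽 p k) {h h′} →
             e ·G h′ ≡ h → _*GA_ 𝔽 (x^ 𝔽 e) r h ≈ r h′
    x^-*GA {k} e r {h} {h′} e·h′≡h = begin
      ΣV 𝔽 p k (λ g → ΣV 𝔽 p k (λ g′ → (x^ 𝔽 e g * r g′) * x^ 𝔽 (g ·G g′) h))
        ≈⟨ ΣV-single p k e (λ g g≢e → ΣV-zero p k (λ g′ → annihilate (x^-≢ (g≢e ∘ ≡.sym)))) ⟩
      ΣV 𝔽 p k (λ g′ → (x^ 𝔽 e e * r g′) * x^ 𝔽 (e ·G g′) h)
        ≈⟨ ΣV-single p k h′ (λ g′ g′≢h′ → trans (*-congˡ (x^-≢ (g′≢h′ ∘ cancel g′))) (zeroʳ _)) ⟩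
      (x^ 𝔽 e e * r h′) * x^ 𝔽 (e ·G h′) h
        ≈⟨ *-cong (*-congʳ (x^-≡ ≡.refl)) (x^-≡ e·h′≡h) ⟩
      (1# * r h′) * 1#
        ≈⟨ trans (*-identityʳ _) (*-identityˡ _) ⟩
      r h′
        ∎
      where
      annihilate : ∀ {x y z} → x ≈ 0# → (x * y) * z ≈ 0#
      annihilate x≈0 = trans (*-congʳ (trans (*-congʳ x≈0) (zeroˡ _))) (zeroˡ _)
      cancel : ∀ g′ → e ·G g′ ≡ h → g′ ≡ h′
      cancel g′ e·g′≡h = ·G-cancelˡ e g′ h′ (≡.trans e·g′≡h (≡.sym e·h′≡h))

    shiftSum-apply : ∀ {k} (i : Fin k) A (s : GA 𝔽 p k) h →
                     shiftSum i A s h ≈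
                     ΣF 𝔽 p (λ a → if ⌊ a ∈? A ⌋ then ρ 𝔽 a s (h [ i ]≔ (a +ₚ lookup h i)) else 0#)
    shiftSum-apply i A s h = ΣF-cong p λ a →
      guarded-cong (a ∈? A) (λ _ → x^-*GA (e[ i ]^- a) (ρ 𝔽 a s) (e^-·G-update i a h))

    shiftSum-on-W₀ : ∀ {k} (i : Fin k) A {s : GA 𝔽 p k} → SupportedOver A s →
                     ∀ h → W 0ₚ h → shiftSum i A s h ≈ lineSum i s h
    shiftSum-on-W₀ i A {s} supp h h∈W₀ = begin
      shiftSum i A s h
        ≈⟨ shiftSum-apply i A s h ⟩
      ΣF 𝔽 p (λ a → if ⌊ a ∈? A ⌋ then ρ 𝔽 a s (h′ a) else 0#)
        ≈⟨ ΣF-cong p dropGuards ⟩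
      ΣF 𝔽 p (λ a → s (h′ a))
        ≈⟨ ΣF-permute p (λ v → s (h [ i ]≔ v)) (translation (lookup h i)) ⟩
      lineSum i s h
        ∎
      where
      h′ : Fin p → Vec (Fin p) _
      h′ a = h [ i ]≔ (a +ₚ lookup h i)
      dropGuards : ∀ a → (if ⌊ a ∈? A ⌋ then ρ 𝔽 a s (h′ a) else 0#) ≈ s (h′ a)
      dropGuards a = trans
        (guarded-cong (a ∈? A) (λ _ → ρ-on s (h′ a) (W₀-update h i a h∈W₀)))
        (guarded-elim (a ∈? A) (λ a∉A → supp (h′ a) (a∉A ∘ ≡.subst (_∈ A) (W₀-update h i a h∈W₀))))

    shiftSum-off-W₀ : ∀ {k} (i : Fin k) A (s : GA 𝔽 p k) h → ¬ W 0ₚ h → shiftSum i A s h ≈ 0#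
    shiftSum-off-W₀ i A s h h∉W₀ = trans (shiftSum-apply i A s h)
      (ΣF-zero p (λ a → guarded-zero (a ∈? A) (λ _ → ρ-off s _ (h∉W₀ ∘ W-update⇒W₀ h i a))))

    Cycle⇒lineSum≈0 : ∀ {k} {φ : Fun 𝔽 p k} → SkewSymmetric 𝔽 φ → Cycle 𝔽 φ →
                      ∀ i → _≈GA_ 𝔽 (lineSum i φ) (0GA 𝔽)
    Cycle⇒lineSum≈0 {suc k} {φ} (antisym , _) cycle i h = begin
      ΣF 𝔽 p (λ v → φ (h [ i ]≔ v))           ≈⟨ ΣF-cong p (λ v → reflexive (cong φ (≡.sym (line v)))) ⟩
      ΣF 𝔽 p (λ v → φ (permute 𝔽 σ (v ∷ β)))  ≈⟨ ΣF-cong p (λ v → antisym (v ∷ β) σ) ⟩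
      ΣF 𝔽 p (λ v → sgn 𝔽 σ * φ (v ∷ β))      ≈⟨ *-distribˡ-ΣF p (sgn 𝔽 σ) _ ⟨
      sgn 𝔽 σ * ΣF 𝔽 p (λ v → φ (v ∷ β))      ≈⟨ *-congˡ (cycle β) ⟩
      sgn 𝔽 σ * 0#                            ≈⟨ zeroʳ _ ⟩
      0#                                      ∎
      where
      σ = transpose Fin.zero i
      β = tail (permute 𝔽 (flip σ) h)
      line : ∀ v → permute 𝔽 σ (v ∷ β) ≡ h [ i ]≔ v
      line v = ≡.trans (permute-update 𝔽 σ (permute 𝔽 (flip σ) h) Fin.zero v)
                       (cong (λ γ → γ [ i ]≔ v) (permute-flip 𝔽 σ h))

    relation⇒Cycle : ∀ {k} (A : Subset p) {s : GA 𝔽 p k} → SupportedOver A s →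
                     (∀ i → _≈GA_ 𝔽 (shiftSum i A s) (0GA 𝔽)) → Cycle 𝔽 s
    relation⇒Cycle {zero}  _ _    _        = _
    relation⇒Cycle {suc k} A supp relation β =
      trans (sym (shiftSum-on-W₀ Fin.zero A supp h (-ₚ-inverseˡ (Σₚ β)))) (relation Fin.zero h)
      where
      h = (-ₚ Σₚ β) ∷ β

    H⇒ℋ : ∀ {k} (A : Subset p) {s : GA 𝔽 p k} → H 𝔽 A s → ℋ 𝔽 A s
    H⇒ℋ A {s} ((skew , supp) , cycle) = ((λ a → ρ 𝔽 a s) , summands , ΣA-ρ A s supp) , relation
      where
      summands : ∀ a → a ∈ A → 𝒮[_] 𝔽 a (ρ 𝔽 a s)
      summands a _ = (ρ 𝔽 a s , ρ-skew a skew , q-identity (ρ 𝔽 a s)) ,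
                     (ρ 𝔽 a s , ρ-off s , q-identity (ρ 𝔽 a s))
      relation : ∀ i → _≈GA_ 𝔽 (shiftSum i A s) (0GA 𝔽)
      relation i h with Σₚ h Fin.≟ 0ₚ
      ... | yes h∈W₀ = trans (shiftSum-on-W₀ i A supp h h∈W₀) (Cycle⇒lineSum≈0 skew cycle i h)
      ... | no  h∉W₀ = shiftSum-off-W₀ i A s h h∉W₀

    ℋ⇒H : ∀ {k} (A : Subset p) {s : GA 𝔽 p k} → ℋ 𝔽 A s → H 𝔽 A s
    ℋ⇒H A {s} ((t , summands , s≈Σt) , relation) = (skew , supp) , relation⇒Cycle A supp relation
      where
      skew : SkewSymmetric 𝔽 s
      skew = SkewSymmetric-resp (λ h → sym (s≈Σt h))
                                (ΣA-skew A (λ a a∈A → 𝒮-skew (proj₁ (summands a a∈A))))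
      supp : SupportedOver A s
      supp γ Σγ∉A = trans (s≈Σt γ) (ΣF-zero p λ a → guarded-zero (a ∈? A) λ a∈A →
        GA[]-support (proj₂ (summands a a∈A)) γ (λ Σγ≡a → Σγ∉A (≡.subst (_∈ A) (≡.sym Σγ≡a) a∈A)))

    q[H]≡ℋ-holds : ∀ k (A : Subset p) → q[H]≡ℋ 𝔽 k A
    q[H]≡ℋ-holds k A =
      (λ φ Hφ → H⇒ℋ A (H-resp (λ h → sym (q-identity φ h)) Hφ)) ,
      (λ s ℋs → s , ℋ⇒H A ℋs , q-identity s)

claim2p1 : {c ℓ : Level} (𝔽 : Field c ℓ) (p : ℕ) (pp : Prime p) (k : ℕ)
    → 1 < k → k < p → (A : Subset p)
    → q[H]≡ℋ 𝔽 {p} {{prime⇒nonZero pp}} k A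
claim2p1 𝔽 p pp k _ _ A = q[H]≡ℋ-holds 𝔽 {{prime⇒nonZero pp}} k A
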